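{- Let $n \ge 2$ and $\boldsymbol{a} = (a_1,\ldots,a_n)^T \in \mathbb{Z}^n_{>0}$ with $a_1 \le a_2 \le \cdots \le a_n$ and $a_1 \ge n$. The inequality $$F(\boldsymbol{a}) \le 2 a_n \left\lfloor \frac{a_1}{n} \right\rfloor - a_1$$ does not hold in general if one only assumes $\gcd(a_1,\ldots,a_n) = 1$: there exists such a vector $\boldsymbol{a}$ with $\gcd(a_1,\ldots,a_n)=1$ for which $F(\boldsymbol{a}) > 2 a_n \lfloor a_1/n \rfloor - a_1$. (Thus the inequality requires stronger hypotheses, such as the entries of $\boldsymbol{a}$ being pairwise coprime, i.e. $\gcd(a_i,a_j)=1$ for all $i \ne j$.)
   Context: For $\boldsymbol{a} = (a_1,\ldots,a_n)^T \in \mathbb{Z}^n_{>0}$ with $n\ge 2$ and $\gcd(a_1,\ldots,a_n)=1$, the Frobenius number is $F(\boldsymbol{a}) := \max\{ b \in \mathbb{Z} : b \neq \boldsymbol{a}^T \boldsymbol{z} \text{ for all } \boldsymbol{z} \in \mathbb{Z}^n_{\ge 0}\}$, the largest integer not representable as a nonnegative integer combination of $a_1,\ldots,a_n$. $\lfloor\cdot\rfloor$ is the floor function. -}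

module Defs where

open import Data.Nat using (ℕ; _*_; _+_)
open import Data.Nat.GCD using (gcd)
open import Data.Fin using (Fin)
open import Data.Vec.Functional using (Vector; foldr)
open import Data.Integer using (ℤ; +_; _<_)
open import Data.Product using (∃; _×_)
open import Relation.Binary.PropositionalEquality using (_≡_)
open import Relation.Nullary using (¬_)

gcdVec : ∀ {n} → Vector ℕ n → ℕ
gcdVec = foldr gcd 0

dot : ∀ {n} → Vector ℕ n → Vector ℕ n → ℕ
dot {n} a z = foldr _+_ 0 (λ i → a i * z i)

Representable : ∀ {n} → Vector ℕ n → ℤ → Set
Representable a b = ∃ λ (z : Vector ℕ _) → b ≡ + (dot a z)

IsFrobeniusNumber : ∀ {n} → Vector ℕ n → ℤ → Set
IsFrobeniusNumber a f =
  ¬ Representable a f × (∀ (b : ℤ) → f < b → Representable a b)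

-- The vector (4, 4, 5) has gcd 1, and its Frobenius number is that of the
-- numerical semigroup generated by 4 and 5, namely 4·5 − 4 − 5 = 11.  The
-- bound of the pairwise coprime case, 2·5·⌊4/3⌋ − 4 = 6, is therefore exceeded;
-- the repeated entry is what breaks pairwise coprimality.
module Submission where

open import Defs
open import Data.Nat using (ℕ; suc; _≤_; _/_; z≤n; s≤s)
import Data.Nat as ℕ
open import Data.Nat.Properties using (≤-refl; ≤-trans; m≤m+n; m≤n+m; *-monoʳ-≤; <-irrefl; m+[n∸m]≡n)
open import Data.Nat.Tactic.RingSolver using (solve-∀)
open import Data.Fin using (Fin; zero; fromℕ; inject₁)
open import Data.Vec.Functional using (Vector; []; _∷_)
open import Data.Integer using (ℤ; +_; _-_; _*_; _<_; +<+; _<?_)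
open import Data.Integer.Properties using (+-injective)
open import Data.Product using (∃; _×_; _,_)
open import Relation.Binary.PropositionalEquality using (_≡_; _≢_; refl; sym; trans; cong)
open import Relation.Nullary using (¬_)
open import Relation.Nullary.Decidable using (from-yes)

a445 : Vector ℕ 3
a445 = 4 ∷ 4 ∷ 5 ∷ []

dot-a445 : ∀ z →
  dot a445 z ≡ 4 ℕ.* (z zero ℕ.+ z (Fin.suc zero)) ℕ.+ 5 ℕ.* z (Fin.suc (Fin.suc zero))
dot-a445 z = regroup (z zero) (z (Fin.suc zero)) (z (Fin.suc (Fin.suc zero)))
  where
  regroup : ∀ x y w → 4 ℕ.* x ℕ.+ (4 ℕ.* y ℕ.+ (5 ℕ.* w ℕ.+ 0)) ≡ 4 ℕ.* (x ℕ.+ y) ℕ.+ 5 ℕ.* w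
  regroup = solve-∀

exceeds-11 : ∀ {n} → 12 ≤ n → n ≢ 11
exceeds-11 12≤n refl = <-irrefl refl 12≤n

4u+5w≢11 : ∀ u w → 4 ℕ.* u ℕ.+ 5 ℕ.* w ≢ 11
4u+5w≢11 (suc (suc (suc u))) w = exceeds-11 (≤-trans 12≤4u (m≤m+n _ (5 ℕ.* w)))
  where
  12≤4u : 12 ≤ 4 ℕ.* suc (suc (suc u))
  12≤4u = *-monoʳ-≤ 4 (s≤s (s≤s (s≤s z≤n)))
4u+5w≢11 u (suc (suc (suc w))) = exceeds-11 (≤-trans 12≤5w (m≤n+m _ (4 ℕ.* u)))
  where
  12≤5w : 12 ≤ 5 ℕ.* suc (suc (suc w))
  12≤5w = ≤-trans (m≤m+n 12 3) (*-monoʳ-≤ 5 (s≤s (s≤s (s≤s z≤n))))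
4u+5w≢11 0 0 ()
4u+5w≢11 0 1 ()
4u+5w≢11 0 2 ()
4u+5w≢11 1 0 ()
4u+5w≢11 1 1 ()
4u+5w≢11 1 2 ()
4u+5w≢11 2 0 ()
4u+5w≢11 2 1 ()
4u+5w≢11 2 2 ()

4u+5w-from-12 : ∀ k → ∃ λ u → ∃ λ w → 4 ℕ.* u ℕ.+ 5 ℕ.* w ≡ 12 ℕ.+ k
4u+5w-from-12 0 = 3 , 0 , refl
4u+5w-from-12 1 = 2 , 1 , refl
4u+5w-from-12 2 = 1 , 2 , refl
4u+5w-from-12 3 = 0 , 3 , refl
4u+5w-from-12 (suc (suc (suc (suc k)))) with 4u+5w-from-12 k
... | u , w , eq = suc u , w , trans (add-4 u w) (cong (4 ℕ.+_) eq)
  where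
  add-4 : ∀ u w → 4 ℕ.* suc u ℕ.+ 5 ℕ.* w ≡ 4 ℕ.+ (4 ℕ.* u ℕ.+ 5 ℕ.* w)
  add-4 = solve-∀

frobenius-a445 : IsFrobeniusNumber a445 (+ 11)
frobenius-a445 = 11-not-representable , above-11-representable
  where
  11-not-representable : ¬ Representable a445 (+ 11)
  11-not-representable (z , eq) =
    4u+5w≢11 (z zero ℕ.+ z (Fin.suc zero)) (z (Fin.suc (Fin.suc zero)))
      (trans (sym (dot-a445 z)) (sym (+-injective eq)))

  above-11-representable : ∀ b → + 11 < b → Representable a445 b
  above-11-representable (+ n) (+<+ 12≤n) with 4u+5w-from-12 (n ℕ.∸ 12)
  ... | u , w , eq =
    (0 ∷ u ∷ w ∷ []) , cong +_ (sym (trans (dot-a445 (0 ∷ u ∷ w ∷ [])) (trans eq (m+[n∸m]≡n 12≤n))))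

proposition1 : ∃ λ (m : ℕ) → ∃ λ (a : Fin (suc m) → ℕ) → ∃ λ (F : ℤ) →
    (1 ≤ m)
    × (∀ i → 1 ≤ a i)
    × (∀ (i : Fin m) → a (inject₁ i) ≤ a (Data.Fin.suc i))
    × (suc m ≤ a zero)
    × (gcdVec a ≡ 1)
    × IsFrobeniusNumber a F
    × ((+ 2) * + (a (fromℕ m)) * + (a zero / suc m) - + (a zero) < F)
proposition1 =
  2 , a445 , + 11 , s≤s z≤n , positive , ascending , s≤s (s≤s (s≤s z≤n)) , refl , frobenius-a445 ,
  from-yes (+ 2 * + 5 * + (4 / 3) - + 4 <? + 11)
  where
  positive : ∀ i → 1 ≤ a445 i
  positive zero = s≤s z≤n
  positive (Fin.suc zero) = s≤s z≤n
  positive (Fin.suc (Fin.suc zero)) = s≤s z≤n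

  ascending : ∀ (i : Fin 2) → a445 (inject₁ i) ≤ a445 (Fin.suc i)
  ascending zero = ≤-refl
  ascending (Fin.suc zero) = m≤n+m 4 1
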